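{- Let $G$ be a connected graph with $d=\operatorname{diam}(G)\in\{3,4\}$. If $\dim(G)=n(G)-d$, then $D(G)=n(G)-2$ if and only if $G\cong P_4$.
   Context: All graphs are finite and simple; $n(G)$ is the number of vertices and $\operatorname{diam}(G)$ the diameter. For a connected graph $G$ with shortest-path distance $d_G$, a set $S\subseteq V(G)$ is a resolving set if for any two distinct vertices $g_1,g_2$ there is $s\in S$ with $d_G(g_1,s)\neq d_G(g_2,s)$; $\dim(G)$ is the minimum size of a resolving set. $D(G)$ is the minimum number of colors in a vertex coloring preserved by no non-trivial automorphism of $G$. $P_4$ is the path on four vertices. -}

module Defs where

open import Data.Nat using (ℕ; zero; suc; _<_; _≤_; _≟_)
open import Data.Bool using (Bool; true; false; _∨_)
import Data.Bool
open import Data.Fin using (Fin; toℕ)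
import Data.Fin as Fin
open import Data.Fin.Subset using (Subset; _∈_; ∣_∣)
open import Data.Product using (Σ; ∃; ∃-syntax; _×_; _,_)
open import Data.Empty using (⊥)
open import Relation.Nullary using (¬_; does)
open import Relation.Binary.PropositionalEquality using (_≡_; _≢_)
open import Function.Bundles using (_↔_; Inverse)

record Graph (n : ℕ) : Set where
  field
    adj    : Fin n → Fin n → Bool
    sym    : ∀ i j → adj i j ≡ adj j i
    irrefl : ∀ i → adj i i ≡ false
open Graph public

Adj : ∀ {n} → Graph n → Fin n → Fin n → Set
Adj G i j = adj G i j ≡ true

data Walk {n : ℕ} (G : Graph n) : Fin n → Fin n → ℕ → Set where
  here : ∀ {u} → Walk G u u zero
  step : ∀ {u v w k} → Adj G u v → Walk G v w k → Walk G u w (suc k)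

-- d_G(u,v) = k : shortest walk (equivalently path) from u to v has length k.
Dist : ∀ {n} → Graph n → Fin n → Fin n → ℕ → Set
Dist G u v k = Walk G u v k × (∀ m → m < k → ¬ Walk G u v m)

Connected : ∀ {n} → Graph n → Set
Connected G = ∀ u v → ∃[ k ] Walk G u v k

Diameter : ∀ {n} → Graph n → ℕ → Set
Diameter G d = (∀ u v k → Dist G u v k → k ≤ d) × (∃[ u ] ∃[ v ] Dist G u v d)

Resolving : ∀ {n} → Graph n → Subset n → Set
Resolving G S = ∀ g₁ g₂ → g₁ ≢ g₂ →
  ∃[ s ] (s ∈ S × ∃[ k₁ ] ∃[ k₂ ] (Dist G g₁ s k₁ × Dist G g₂ s k₂ × k₁ ≢ k₂))

MetricDim : ∀ {n} → Graph n → ℕ → Set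
MetricDim G m = (∃[ S ] (Resolving G S × ∣ S ∣ ≡ m)) × (∀ S → Resolving G S → m ≤ ∣ S ∣)

record Automorphism {n : ℕ} (G : Graph n) : Set where
  field
    perm     : Fin n ↔ Fin n
    preserve : ∀ i j → adj G (Inverse.to perm i) (Inverse.to perm j) ≡ adj G i j
open Automorphism public

NonTrivial : ∀ {n} {G : Graph n} → Automorphism G → Set
NonTrivial σ = ∃[ i ] (Inverse.to (perm σ) i ≢ i)

Distinguishing : ∀ {n c} (G : Graph n) → (Fin n → Fin c) → Set
Distinguishing G col = (σ : Automorphism G) → NonTrivial σ →
  ¬ (∀ i → col (Inverse.to (perm σ) i) ≡ col i)

DistNum : ∀ {n} → Graph n → ℕ → Set
DistNum {n} G m = (Σ (Fin n → Fin m) λ col → Distinguishing G col)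
  × (∀ c (col : Fin n → Fin c) → Distinguishing G col → m ≤ c)

_≅_ : ∀ {n m} → Graph n → Graph m → Set
_≅_ {n} {m} G H = Σ (Fin n ↔ Fin m) λ f →
  ∀ i j → adj H (Inverse.to f i) (Inverse.to f j) ≡ adj G i j

p4adj : Fin 4 → Fin 4 → Bool
p4adj i j = does (toℕ i ≟ suc (toℕ j)) ∨ does (toℕ j ≟ suc (toℕ i))

p4sym : ∀ i j → p4adj i j ≡ p4adj j i
p4sym i j with does (toℕ i ≟ suc (toℕ j)) | does (toℕ j ≟ suc (toℕ i))
... | false | false = Relation.Binary.PropositionalEquality.refl
... | false | true = Relation.Binary.PropositionalEquality.refl
... | true | false = Relation.Binary.PropositionalEquality.refl
... | true | true = Relation.Binary.PropositionalEquality.refl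

p4irrefl : ∀ i → p4adj i i ≡ false
p4irrefl Fin.zero = Relation.Binary.PropositionalEquality.refl
p4irrefl (Fin.suc Fin.zero) = Relation.Binary.PropositionalEquality.refl
p4irrefl (Fin.suc (Fin.suc Fin.zero)) = Relation.Binary.PropositionalEquality.refl
p4irrefl (Fin.suc (Fin.suc (Fin.suc Fin.zero))) = Relation.Binary.PropositionalEquality.refl

P₄ : Graph 4
P₄ = record { adj = p4adj ; sym = p4sym ; irrefl = p4irrefl }

{-# OPTIONS --safe #-}
module Submission where

-- A diametral path of G begins with a geodesic u₀u₁u₂u₃. Suppose some vertex w lies off it, and
-- colour u₀,…,u₃ alike and every other vertex on its own, using n − 3 colours. An automorphism
-- preserving this colouring fixes all other vertices and permutes the geodesic; since path vertices
-- are determined by their distance to u₀ (or u₃), it is trivial unless it reverses the geodesic, and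
-- then fixing w gives d(u₁,w) = d(u₂,w). In that case colour {u₀,u₁,u₂} alike and {u₃,w} alike
-- instead: an automorphism preserving this colouring either fixes u₃, hence everything, or sends u₃
-- to w, and then its inverse sends u₁ and u₂ to path vertices at the same distance d(u₁,w) = d(u₂,w)
-- from u₃, so u₁ = u₂. Either way D(G) ≤ n − 3. Hence D(G) = n − 2 forces V(G) = {u₀,…,u₃}, that is
-- G ≅ P₄; conversely D(P₄) = 2, by colouring one end apart.

open import Defs hiding (sym)
open import Data.Bool using (false)
open import Data.Bool.Properties using (¬-not) renaming (_≟_ to _≟ᵇ_)
open import Data.Empty using (⊥-elim)
open import Data.Fin using (Fin; suc; toℕ; punchOut; opposite)
open import Data.Fin.Patterns using (0F; 1F; 2F; 3F)
open import Data.Fin.Permutation using (↔⇒≡)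
open import Data.Fin.Properties
  using (_≟_; toℕ-injective; toℕ≤pred[n]; punchOut-injective; injective⇒≤; any?; all?; ¬∀⟶∃¬; ¬Fin0;
         opposite-involutive)
open import Data.Nat using (ℕ; suc; _+_; _∸_; _<_; _≤_; z≤n; s≤s)
open import Data.Nat.Properties using (<-cmp; 1+n≰n; +-monoˡ-<; +-monoʳ-<; ∸-cancelˡ-≡)
open import Data.Product using (∃-syntax; _×_; _,_; proj₁; proj₂)
import Data.Product as Product
open import Data.Sum using (_⊎_; inj₁; inj₂)
import Data.Sum as Sum
open import Data.Unit using (tt)
open import Function using (_∘_; id)
open import Function.Bundles using (_⇔_; Inverse; Injection; mk⇔; mk↔ₛ′)
open import Function.Construct.Composition using (_↔-∘_)
open import Function.Construct.Symmetry using (↔-sym)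
open import Function.Properties.Inverse using (↔⇒↣)
open import Level using (0ℓ)
open import Relation.Binary using (Rel; _⇒_; tri<; tri≈; tri>)
open import Relation.Binary.PropositionalEquality using (_≡_; _≢_; refl; sym; trans; cong; cong₂; subst; subst₂)
open import Relation.Nullary using (¬_; yes; no)
open import Relation.Nullary.Decidable using (toWitness)
open import Relation.Unary using (Pred; Decidable; _∪_; ｛_｝; _∉_; _⊆_)

module WalkProperties {n : ℕ} (G : Graph n) where

  adj-sym : ∀ {x y} → Adj G x y → Adj G y x
  adj-sym {x} {y} xy = trans (Graph.sym G y x) xy

  _++_ : ∀ {x y z k l} → Walk G x y k → Walk G y z l → Walk G x z (k + l)
  here      ++ q = q
  step xy p ++ q = step xy (p ++ q)

  _∷ʳ_ : ∀ {x y z k} → Walk G x y k → Adj G y z → Walk G x z (suc k)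
  here      ∷ʳ yz = step yz here
  step xy p ∷ʳ yz = step xy (p ∷ʳ yz)

  reverse : ∀ {x y k} → Walk G x y k → Walk G y x k
  reverse here        = here
  reverse (step xy p) = reverse p ∷ʳ adj-sym xy

  dist-refl : ∀ {x} → Dist G x x 0
  dist-refl = here , λ _ ()

  dist-sym : ∀ {x y k} → Dist G x y k → Dist G y x k
  dist-sym (p , shortest) = reverse p , λ m m<k q → shortest m m<k (reverse q)

  dist-unique : ∀ {x y k l} → Dist G x y k → Dist G x y l → k ≡ l
  dist-unique {k = k} {l} (p , p-shortest) (q , q-shortest) with <-cmp k l
  ... | tri< k<l _ _ = ⊥-elim (q-shortest k k<l p)
  ... | tri≈ _ k≡l _ = k≡l
  ... | tri> _ _ l<k = ⊥-elim (p-shortest l l<k q)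

  dist-prefix : ∀ {x y z k l} → Dist G x z (k + l) → Walk G x y k → Walk G y z l → Dist G x y k
  dist-prefix {l = l} (_ , shortest) p q = p , λ m m<k r → shortest (m + l) (+-monoˡ-< l m<k) (r ++ q)

  dist-suffix : ∀ {x y z k l} → Dist G x z (k + l) → Walk G x y k → Walk G y z l → Dist G y z l
  dist-suffix {k = k} (_ , shortest) p q = q , λ m m<l r → shortest (k + m) (+-monoʳ-< k m<l) (p ++ r)

  far⇒nonadjacent : ∀ {x y k} → Dist G x y (2 + k) → adj G x y ≡ false
  far⇒nonadjacent (_ , shortest) = ¬-not λ xy → shortest 1 (s≤s (s≤s z≤n)) (step xy here)

walk-map : ∀ {n m} {G : Graph n} {H : Graph m} (f : Fin n → Fin m) →
           (∀ i j → adj H (f i) (f j) ≡ adj G i j) →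
           ∀ {x y k} → Walk G x y k → Walk H (f x) (f y) k
walk-map f preserves here        = here
walk-map f preserves (step xy p) = step (trans (preserves _ _) xy) (walk-map f preserves p)

≅-sym : ∀ {n m} {G : Graph n} {H : Graph m} → G ≅ H → H ≅ G
≅-sym {H = H} (f , preserves) = ↔-sym f , λ i j →
  trans (sym (preserves (from i) (from j))) (cong₂ (adj H) (strictlyInverseˡ i) (strictlyInverseˡ j))
  where open Inverse f

≅-trans : ∀ {n m l} {G : Graph n} {H : Graph m} {K : Graph l} → G ≅ H → H ≅ K → G ≅ K
≅-trans (f , f-preserves) (g , g-preserves) =
  g ↔-∘ f , λ i j → trans (g-preserves (Inverse.to f i) (Inverse.to f j)) (f-preserves i j)

module _ {n : ℕ} {G : Graph n} where

  automorphism : G ≅ G → Automorphism G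
  automorphism (f , preserves) = record { perm = f ; preserve = preserves }

  _⟨$⟩_ : Automorphism G → Fin n → Fin n
  σ ⟨$⟩ x = Inverse.to (perm σ) x

  inverse : Automorphism G → Automorphism G
  inverse σ = automorphism (≅-sym {G = G} {H = G} (perm σ , preserve σ))

  module _ (σ : Automorphism G) where
    open Inverse (perm σ) using (strictlyInverseʳ)

    ⟨$⟩-injective : ∀ {x y} → σ ⟨$⟩ x ≡ σ ⟨$⟩ y → x ≡ y
    ⟨$⟩-injective = Injection.injective (↔⇒↣ (perm σ))

    walk-image : ∀ {x y k} → Walk G x y k → Walk G (σ ⟨$⟩ x) (σ ⟨$⟩ y) k
    walk-image = walk-map (σ ⟨$⟩_) (preserve σ)

    walk-preimage : ∀ {x y k} → Walk G (σ ⟨$⟩ x) (σ ⟨$⟩ y) k → Walk G x y k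
    walk-preimage {x} {y} {k} p =
      subst₂ (λ x′ y′ → Walk G x′ y′ k) (strictlyInverseʳ x) (strictlyInverseʳ y)
        (walk-map (inverse σ ⟨$⟩_) (preserve (inverse σ)) p)

    image-preimage : ∀ y → σ ⟨$⟩ (inverse σ ⟨$⟩ y) ≡ y
    image-preimage = Inverse.strictlyInverseˡ (perm σ)

    dist-image : ∀ {x y x′ y′ k} → σ ⟨$⟩ x ≡ x′ → σ ⟨$⟩ y ≡ y′ → Dist G x y k → Dist G x′ y′ k
    dist-image refl refl (p , shortest) = walk-image p , λ m m<k q → shortest m m<k (walk-preimage q)

    dist-preimage : ∀ {x y x′ y′ k} → σ ⟨$⟩ x ≡ x′ → σ ⟨$⟩ y ≡ y′ → Dist G x′ y′ k → Dist G x y k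
    dist-preimage refl refl (p , shortest) = walk-preimage p , λ m m<k q → shortest m m<k (walk-image q)

conjugate : ∀ {n m} {G : Graph n} {H : Graph m} → G ≅ H → Automorphism G → Automorphism H
conjugate {G = G} {H} iso σ =
  automorphism (≅-trans {G = H} {G} {H} (≅-sym {G = G} {H} iso) (≅-trans {G = G} {G} {H} (perm σ , preserve σ) iso))

distinguishing-pullback : ∀ {n m c} {G : Graph n} {H : Graph m} {col : Fin m → Fin c}
  (iso : G ≅ H) → Distinguishing H col → Distinguishing G (col ∘ Inverse.to (proj₁ iso))
distinguishing-pullback {G = G} {H} {col} iso@(f , _) distinguishes σ (x , σx≢x) preserves =
  distinguishes (conjugate {G = G} {H} iso σ) (to x , moved)
    λ y → trans (preserves (from y)) (cong col (strictlyInverseˡ y))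
  where
  open Inverse f
  moved : to (σ ⟨$⟩ from (to x)) ≢ to x
  moved eq = σx≢x (Injection.injective (↔⇒↣ f) (trans (cong (to ∘ (σ ⟨$⟩_)) (sym (strictlyInverseʳ x))) eq))

distNum-resp-≅ : ∀ {n m c} {G : Graph n} {H : Graph m} → G ≅ H → DistNum H c → DistNum G c
distNum-resp-≅ {G = G} {H} iso ((col , distinguishes) , minimal) =
  (col ∘ Inverse.to (proj₁ iso) , distinguishing-pullback {G = G} {H} iso distinguishes) ,
  λ c col′ distinguishes′ →
    minimal c (col′ ∘ Inverse.from (proj₁ iso)) (distinguishing-pullback {G = H} {G} (≅-sym {G = G} {H} iso) distinguishes′)

-- punchOut removes b from the palette; b itself takes the new colour of a.
merge : ∀ {k} {a b : Fin (suc k)} → a ≢ b → Fin (suc k) → Fin k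
merge {b = b} a≢b x with x ≟ b
... | yes _   = punchOut (a≢b ∘ sym)
... | no x≢b  = punchOut (x≢b ∘ sym)

merge-kernel : ∀ {k} {a b : Fin (suc k)} (a≢b : a ≢ b) {x y} → merge a≢b x ≡ merge a≢b y →
               x ≡ y ⊎ ((x ≡ a ⊎ x ≡ b) × (y ≡ a ⊎ y ≡ b))
merge-kernel {b = b} a≢b {x} {y} eq with x ≟ b | y ≟ b
... | yes x≡b | yes y≡b = inj₁ (trans x≡b (sym y≡b))
... | yes x≡b | no y≢b  = inj₂ (inj₂ x≡b , inj₁ (sym (punchOut-injective (a≢b ∘ sym) (y≢b ∘ sym) eq)))
... | no x≢b  | yes y≡b = inj₂ (inj₁ (punchOut-injective (x≢b ∘ sym) (a≢b ∘ sym) eq) , inj₂ y≡b)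
... | no x≢b  | no y≢b  = inj₁ (punchOut-injective (x≢b ∘ sym) (y≢b ∘ sym) eq)

record Colouring (n k : ℕ) (R : Rel (Fin n) 0ℓ) : Set where
  field
    colour    : Fin n → Fin k
    separates : ∀ {x y} → colour x ≡ colour y → R x y
open Colouring

module _ {n : ℕ} where

  discrete : Colouring n n _≡_
  discrete = record { colour = id ; separates = id }

  weaken : ∀ {k} {R R′ : Rel (Fin n) 0ℓ} → R ⇒ R′ → Colouring n k R → Colouring n k R′
  weaken R⇒R′ c = record { colour = colour c ; separates = R⇒R′ ∘ separates c }

  JoinClasses : Rel (Fin n) 0ℓ → Fin n → Fin n → Rel (Fin n) 0ℓ
  JoinClasses R a b x y = R x y ⊎ ((R x a ⊎ R x b) × (R y a ⊎ R y b))

  join-classes : ∀ {k} {R : Rel (Fin n) 0ℓ} {a b} → Colouring n (suc k) R → ¬ R a b →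
                 Colouring n k (JoinClasses R a b)
  join-classes {R = R} {a} {b} c ¬Rab = record
    { colour    = merge a≢b ∘ colour c
    ; separates = λ eq → Sum.map (separates c) (Product.map near near) (merge-kernel a≢b eq)
    }
    where
    a≢b : colour c a ≢ colour c b
    a≢b = ¬Rab ∘ separates c
    near : ∀ {x} → colour c x ≡ colour c a ⊎ colour c x ≡ colour c b → R x a ⊎ R x b
    near = Sum.map (separates c) (separates c)

  EqualOrBoth : Pred (Fin n) 0ℓ → Rel (Fin n) 0ℓ
  EqualOrBoth B x y = x ≡ y ⊎ (B x × B y)

  EqualOrBoth-mono : ∀ {B B′ : Pred (Fin n) 0ℓ} → B ⊆ B′ → EqualOrBoth B ⇒ EqualOrBoth B′
  EqualOrBoth-mono B⊆B′ = Sum.map₂ (Product.map B⊆B′ B⊆B′)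

  absorb : ∀ {k} {B : Pred (Fin n) 0ℓ} {a b} → Colouring n (suc k) (EqualOrBoth B) → B a → b ∉ B →
           Colouring n k (EqualOrBoth (B ∪ ｛ b ｝))
  absorb {B = B} {a} {b} c a∈B b∉B = weaken joined (join-classes c λ where
      (inj₁ refl)      → b∉B a∈B
      (inj₂ (_ , b∈B)) → b∉B b∈B)
    where
    near : ∀ {x} → EqualOrBoth B x a ⊎ EqualOrBoth B x b → (B ∪ ｛ b ｝) x
    near (inj₁ (inj₁ refl))      = inj₁ a∈B
    near (inj₁ (inj₂ (x∈B , _))) = inj₁ x∈B
    near (inj₂ (inj₁ refl))      = inj₂ refl
    near (inj₂ (inj₂ (x∈B , _))) = inj₁ x∈B
    joined : JoinClasses (EqualOrBoth B) a b ⇒ EqualOrBoth (B ∪ ｛ b ｝)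
    joined (inj₁ x≈y)       = EqualOrBoth-mono inj₁ x≈y
    joined (inj₂ (nx , ny)) = inj₂ (near nx , near ny)

  EqualOrBoth₂ : Pred (Fin n) 0ℓ → Pred (Fin n) 0ℓ → Rel (Fin n) 0ℓ
  EqualOrBoth₂ B C x y = EqualOrBoth B x y ⊎ (C x × C y)

  pair-up : ∀ {k} {B : Pred (Fin n) 0ℓ} {a b} → Colouring n (suc k) (EqualOrBoth B) → a ∉ B → b ∉ B → a ≢ b →
            Colouring n k (EqualOrBoth₂ B (｛ a ｝ ∪ ｛ b ｝))
  pair-up {B = B} {a} {b} c a∉B b∉B a≢b = weaken joined (join-classes c λ where
      (inj₁ a≡b)       → a≢b a≡b
      (inj₂ (a∈B , _)) → a∉B a∈B)
    where
    near : ∀ {x} → EqualOrBoth B x a ⊎ EqualOrBoth B x b → (｛ a ｝ ∪ ｛ b ｝) x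
    near (inj₁ (inj₁ refl))      = inj₁ refl
    near (inj₁ (inj₂ (_ , a∈B))) = ⊥-elim (a∉B a∈B)
    near (inj₂ (inj₁ refl))      = inj₂ refl
    near (inj₂ (inj₂ (_ , b∈B))) = ⊥-elim (b∉B b∈B)
    joined : JoinClasses (EqualOrBoth B) a b ⇒ EqualOrBoth₂ B (｛ a ｝ ∪ ｛ b ｝)
    joined (inj₁ x≈y)       = inj₁ x≈y
    joined (inj₂ (nx , ny)) = inj₂ (near nx , near ny)

record Geodesic₃ {n} (G : Graph n) : Set where
  field
    u₀ u₁ u₂ u₃ : Fin n
    u₀~u₁ : Adj G u₀ u₁
    u₁~u₂ : Adj G u₁ u₂
    u₂~u₃ : Adj G u₂ u₃
    shortest : ∀ m → m < 3 → ¬ Walk G u₀ u₃ m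

module Geodesic₃Properties {n : ℕ} {G : Graph n} (γ : Geodesic₃ G) where
  open Geodesic₃ γ public
  open WalkProperties G

  u : Fin 4 → Fin n
  u 0F = u₀
  u 1F = u₁
  u 2F = u₂
  u 3F = u₃

  geodesic : Dist G u₀ u₃ 3
  geodesic = step u₀~u₁ (step u₁~u₂ (step u₂~u₃ here)) , shortest

  dist-from-u₀ : ∀ i → Dist G u₀ (u i) (toℕ i)
  dist-from-u₀ 0F = dist-refl
  dist-from-u₀ 1F = dist-prefix geodesic (step u₀~u₁ here) (step u₁~u₂ (step u₂~u₃ here))
  dist-from-u₀ 2F = dist-prefix geodesic (step u₀~u₁ (step u₁~u₂ here)) (step u₂~u₃ here)
  dist-from-u₀ 3F = geodesic

  dist-to-u₃ : ∀ i → Dist G (u i) u₃ (3 ∸ toℕ i)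
  dist-to-u₃ 0F = geodesic
  dist-to-u₃ 1F = dist-suffix geodesic (step u₀~u₁ here) (step u₁~u₂ (step u₂~u₃ here))
  dist-to-u₃ 2F = dist-suffix geodesic (step u₀~u₁ (step u₁~u₂ here)) (step u₂~u₃ here)
  dist-to-u₃ 3F = dist-refl

  u-injective : ∀ {i j} → u i ≡ u j → i ≡ j
  u-injective {i} {j} uᵢ≡uⱼ =
    toℕ-injective (dist-unique (dist-from-u₀ i) (subst (λ x → Dist G u₀ x (toℕ j)) (sym uᵢ≡uⱼ) (dist-from-u₀ j)))

  u-distinct : ∀ {i j} → i ≢ j → u i ≢ u j
  u-distinct i≢j = i≢j ∘ u-injective

  four≤n : 4 ≤ n
  four≤n = injective⇒≤ u-injective

  OnPath : Pred (Fin n) 0ℓ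
  OnPath x = ∃[ i ] u i ≡ x

  onPath? : Decidable OnPath
  onPath? x = any? λ i → u i ≟ x

  dist-from-u₀-injective : ∀ {x y d} → OnPath x → OnPath y → Dist G u₀ x d → Dist G u₀ y d → x ≡ y
  dist-from-u₀-injective (i , refl) (j , refl) dᵢ dⱼ =
    cong u (toℕ-injective (trans (dist-unique (dist-from-u₀ i) dᵢ) (dist-unique dⱼ (dist-from-u₀ j))))

  dist-to-u₃-injective : ∀ {x y d} → OnPath x → OnPath y → Dist G x u₃ d → Dist G y u₃ d → x ≡ y
  dist-to-u₃-injective (i , refl) (j , refl) dᵢ dⱼ =
    cong u (toℕ-injective (∸-cancelˡ-≡ (toℕ≤pred[n] i) (toℕ≤pred[n] j)
      (trans (dist-unique (dist-to-u₃ i) dᵢ) (dist-unique dⱼ (dist-to-u₃ j)))))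

  Near : Fin n → Fin n → Set
  Near x y = ∃[ m ] (m < 3 × Walk G x y m)

  ¬near : ∀ {x y} → Dist G x y 3 → ¬ Near x y
  ¬near (_ , shortest) (m , m<3 , p) = shortest m m<3 p

  u₁-near : ∀ j → Near u₁ (u j)
  u₁-near 0F = 1 , s≤s (s≤s z≤n) , step (adj-sym u₀~u₁) here
  u₁-near 1F = 0 , s≤s z≤n , here
  u₁-near 2F = 1 , s≤s (s≤s z≤n) , step u₁~u₂ here
  u₁-near 3F = 2 , s≤s (s≤s (s≤s z≤n)) , step u₁~u₂ (step u₂~u₃ here)

  u₂-near : ∀ j → Near u₂ (u j)
  u₂-near 0F = 2 , s≤s (s≤s (s≤s z≤n)) , step (adj-sym u₁~u₂) (step (adj-sym u₀~u₁) here)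
  u₂-near 1F = 1 , s≤s (s≤s z≤n) , step (adj-sym u₁~u₂) here
  u₂-near 2F = 0 , s≤s z≤n , here
  u₂-near 3F = 1 , s≤s (s≤s z≤n) , step u₂~u₃ here

  at-distance-3⇒end : ∀ {i j} → Dist G (u i) (u j) 3 → i ≡ 0F ⊎ i ≡ 3F
  at-distance-3⇒end {0F}     _ = inj₁ refl
  at-distance-3⇒end {1F} {j} d = ⊥-elim (¬near d (u₁-near j))
  at-distance-3⇒end {2F} {j} d = ⊥-elim (¬near d (u₂-near j))
  at-distance-3⇒end {3F}     _ = inj₂ refl

  module _ (σ : Automorphism G) where

    PathStable : Set
    PathStable = ∀ i → OnPath (σ ⟨$⟩ u i)

    FixesOffPath : Set
    FixesOffPath = ∀ x → x ∉ OnPath → σ ⟨$⟩ x ≡ x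

    fixing-u₀⇒fixes-path : σ ⟨$⟩ u₀ ≡ u₀ → PathStable → ∀ j → σ ⟨$⟩ u j ≡ u j
    fixing-u₀⇒fixes-path σu₀≡u₀ stable j = dist-from-u₀-injective (stable j) (j , refl)
      (dist-image σ σu₀≡u₀ refl (dist-from-u₀ j)) (dist-from-u₀ j)

    fixing-u₃⇒fixes-path : σ ⟨$⟩ u₃ ≡ u₃ → PathStable → ∀ j → σ ⟨$⟩ u j ≡ u j
    fixing-u₃⇒fixes-path σu₃≡u₃ stable j = dist-to-u₃-injective (stable j) (j , refl)
      (dist-image σ refl σu₃≡u₃ (dist-to-u₃ j)) (dist-to-u₃ j)

    fixes-path⇒trivial : (∀ j → σ ⟨$⟩ u j ≡ u j) → FixesOffPath → ¬ NonTrivial σ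
    fixes-path⇒trivial fixes-path fixes-rest (x , σx≢x) with onPath? x
    ... | yes (j , refl) = σx≢x (fixes-path j)
    ... | no x∉path      = σx≢x (fixes-rest x x∉path)

    nontrivial⇒reverses-path : PathStable → FixesOffPath → NonTrivial σ → σ ⟨$⟩ u₁ ≡ u₂
    nontrivial⇒reverses-path stable fixes-rest nontrivial with stable 0F | stable 3F
    ... | i , uᵢ≡σu₀ | j , uⱼ≡σu₃
      with at-distance-3⇒end {i} {j} (dist-image σ (sym uᵢ≡σu₀) (sym uⱼ≡σu₃) geodesic)
    ... | inj₁ refl = ⊥-elim (fixes-path⇒trivial (fixing-u₀⇒fixes-path (sym uᵢ≡σu₀) stable) fixes-rest nontrivial)
    ... | inj₂ refl = dist-to-u₃-injective (stable 1F) (2F , refl)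
      (dist-image σ refl (sym uᵢ≡σu₀) (dist-sym (dist-from-u₀ 1F))) (dist-to-u₃ 2F)

  adj-u : ∀ i j → adj G (u i) (u j) ≡ p4adj i j
  adj-u 0F 0F = irrefl G u₀
  adj-u 0F 1F = u₀~u₁
  adj-u 0F 2F = far⇒nonadjacent (dist-from-u₀ 2F)
  adj-u 0F 3F = far⇒nonadjacent geodesic
  adj-u 1F 0F = adj-sym u₀~u₁
  adj-u 1F 1F = irrefl G u₁
  adj-u 1F 2F = u₁~u₂
  adj-u 1F 3F = far⇒nonadjacent (dist-to-u₃ 1F)
  adj-u 2F 0F = far⇒nonadjacent (dist-sym (dist-from-u₀ 2F))
  adj-u 2F 1F = adj-sym u₁~u₂
  adj-u 2F 2F = irrefl G u₂
  adj-u 2F 3F = u₂~u₃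
  adj-u 3F 0F = far⇒nonadjacent (dist-sym geodesic)
  adj-u 3F 1F = far⇒nonadjacent (dist-sym (dist-to-u₃ 1F))
  adj-u 3F 2F = adj-sym u₂~u₃
  adj-u 3F 3F = irrefl G u₃

  spanning⇒≅P₄ : (∀ x → OnPath x) → G ≅ P₄
  spanning⇒≅P₄ spanning = mk↔ₛ′ index u index-u u-index , λ x y →
    trans (sym (adj-u (index x) (index y))) (cong₂ (adj G) (u-index x) (u-index y))
    where
    index : Fin n → Fin 4
    index x = proj₁ (spanning x)
    u-index : ∀ x → u (index x) ≡ x
    u-index x = proj₂ (spanning x)
    index-u : ∀ i → index (u i) ≡ i
    index-u i = u-injective (u-index (u i))

P₄-geodesic : Geodesic₃ P₄
P₄-geodesic = record
  { u₀ = 0F ; u₁ = 1F ; u₂ = 2F ; u₃ = 3F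
  ; u₀~u₁ = refl ; u₁~u₂ = refl ; u₂~u₃ = refl
  ; shortest = no-short-walk
  }
  where
  no-short-walk : ∀ m → m < 3 → ¬ Walk P₄ 0F 3F m
  no-short-walk 0 _ ()
  no-short-walk 1 _ (step () here)
  no-short-walk 2 _ (step {v = 0F} () _)
  no-short-walk 2 _ (step {v = 1F} _ (step () here))
  no-short-walk 2 _ (step {v = 2F} () _)
  no-short-walk 2 _ (step {v = 3F} () _)
  no-short-walk (suc (suc (suc _))) (s≤s (s≤s (s≤s ()))) _

reversal : Automorphism P₄
reversal = record
  { perm     = mk↔ₛ′ opposite opposite opposite-involutive opposite-involutive
  ; preserve = toWitness {a? = all? λ i → all? λ j → p4adj (opposite i) (opposite j) ≟ᵇ p4adj i j} tt
  }

end-marker : Fin 4 → Fin 2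
end-marker 0F = 0F
end-marker _  = 1F

end-marker-distinguishes : Distinguishing P₄ end-marker
end-marker-distinguishes σ (x , σx≢x) preserves = σx≢x (subst (λ y → σ ⟨$⟩ y ≡ y) (u-spans x) (fixes-path x))
  where
  open Geodesic₃Properties P₄-geodesic
  u-spans : ∀ i → u i ≡ i
  u-spans 0F = refl
  u-spans 1F = refl
  u-spans 2F = refl
  u-spans 3F = refl
  fixes-0 : σ ⟨$⟩ 0F ≡ 0F
  fixes-0 with σ ⟨$⟩ 0F | preserves 0F
  ... | 0F    | _  = refl
  ... | suc _ | ()
  fixes-path : ∀ j → σ ⟨$⟩ u j ≡ u j
  fixes-path = fixing-u₀⇒fixes-path σ fixes-0 λ i → σ ⟨$⟩ u i , u-spans (σ ⟨$⟩ u i)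

P₄-needs-two-colours : ∀ c (col : Fin 4 → Fin c) → Distinguishing P₄ col → 2 ≤ c
P₄-needs-two-colours 0             col _             = ⊥-elim (¬Fin0 (col 0F))
P₄-needs-two-colours 1             col distinguishes = ⊥-elim (distinguishes reversal (0F , λ ()) λ _ → one-colour _ _)
  where
  one-colour : (a b : Fin 1) → a ≡ b
  one-colour 0F 0F = refl
P₄-needs-two-colours (suc (suc _)) _   _             = s≤s (s≤s z≤n)

distNum-P₄ : DistNum P₄ 2
distNum-P₄ = (end-marker , end-marker-distinguishes) , P₄-needs-two-colours

module SpareVertex {k : ℕ} {G : Graph (3 + k)} (γ : Geodesic₃ G)
                   (w : Fin (3 + k)) (w∉path : w ∉ Geodesic₃Properties.OnPath γ) where
  open Geodesic₃Properties γ

  Inner : Pred (Fin (3 + k)) 0ℓ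
  Inner = (｛ u₀ ｝ ∪ ｛ u₁ ｝) ∪ ｛ u₂ ｝

  Tail : Pred (Fin (3 + k)) 0ℓ
  Tail = ｛ u₃ ｝ ∪ ｛ w ｝

  inner⇒onPath : Inner ⊆ OnPath
  inner⇒onPath (inj₁ (inj₁ refl)) = 0F , refl
  inner⇒onPath (inj₁ (inj₂ refl)) = 1F , refl
  inner⇒onPath (inj₂ refl)        = 2F , refl

  u₃∉Inner : u₃ ∉ Inner
  u₃∉Inner (inj₁ (inj₁ u₀≡u₃)) = u-distinct {0F} {3F} (λ ()) u₀≡u₃
  u₃∉Inner (inj₁ (inj₂ u₁≡u₃)) = u-distinct {1F} {3F} (λ ()) u₁≡u₃
  u₃∉Inner (inj₂ u₂≡u₃)        = u-distinct {2F} {3F} (λ ()) u₂≡u₃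

  inner-merged : Colouring (3 + k) (suc k) (EqualOrBoth Inner)
  inner-merged = absorb (absorb (weaken inj₁ discrete) refl (u-distinct {0F} {1F} λ ())) (inj₁ refl)
    λ where
      (inj₁ u₀≡u₂) → u-distinct {0F} {2F} (λ ()) u₀≡u₂
      (inj₂ u₁≡u₂) → u-distinct {1F} {2F} (λ ()) u₁≡u₂

  path-merged : Colouring (3 + k) k (EqualOrBoth OnPath)
  path-merged = weaken (EqualOrBoth-mono onPath) (absorb inner-merged (inj₁ (inj₁ refl)) u₃∉Inner)
    where
    onPath : Inner ∪ ｛ u₃ ｝ ⊆ OnPath
    onPath (inj₁ x∈Inner) = inner⇒onPath x∈Inner
    onPath (inj₂ refl)    = 3F , refl

  split-merged : Colouring (3 + k) k (EqualOrBoth₂ Inner Tail)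
  split-merged = pair-up inner-merged u₃∉Inner (w∉path ∘ inner⇒onPath) λ u₃≡w → w∉path (3F , u₃≡w)

  Equidistant : Set
  Equidistant = ∀ {d} → Dist G u₁ w d → Dist G u₂ w d

  path-merged-not-distinguishing⇒equidistant : (σ : Automorphism G) → NonTrivial σ →
    (∀ x → colour path-merged (σ ⟨$⟩ x) ≡ colour path-merged x) → Equidistant
  path-merged-not-distinguishing⇒equidistant σ nontrivial preserves =
    dist-image σ (nontrivial⇒reverses-path σ stable fixes-rest nontrivial) (fixes-rest w w∉path)
    where
    related : ∀ x → EqualOrBoth OnPath (σ ⟨$⟩ x) x
    related x = separates path-merged (preserves x)
    stable : PathStable σ
    stable i with related (u i)
    ... | inj₁ σuᵢ≡uᵢ         = i , sym σuᵢ≡uᵢ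
    ... | inj₂ (σuᵢ∈path , _) = σuᵢ∈path
    fixes-rest : FixesOffPath σ
    fixes-rest x x∉path with related x
    ... | inj₁ σx≡x         = σx≡x
    ... | inj₂ (_ , x∈path) = ⊥-elim (x∉path x∈path)

  module _ (σ : Automorphism G) (related : ∀ x → EqualOrBoth₂ Inner Tail (σ ⟨$⟩ x) x) where

    fixing-u₃⇒trivial : σ ⟨$⟩ u₃ ≡ u₃ → ¬ NonTrivial σ
    fixing-u₃⇒trivial σu₃≡u₃ = fixes-path⇒trivial σ (fixing-u₃⇒fixes-path σ σu₃≡u₃ stable) fixes-rest
      where
      stable : PathStable σ
      stable j with related (u j)
      ... | inj₁ (inj₁ σuⱼ≡uⱼ)         = j , sym σuⱼ≡uⱼ
      ... | inj₁ (inj₂ (σuⱼ∈Inner , _)) = inner⇒onPath σuⱼ∈Inner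
      ... | inj₂ (_ , inj₁ u₃≡uⱼ)       = 3F , trans (sym σu₃≡u₃) (cong (σ ⟨$⟩_) u₃≡uⱼ)
      ... | inj₂ (_ , inj₂ w≡uⱼ)        = ⊥-elim (w∉path (j , sym w≡uⱼ))
      fixes-rest : FixesOffPath σ
      fixes-rest x x∉path with related x
      ... | inj₁ (inj₁ σx≡x)          = σx≡x
      ... | inj₁ (inj₂ (_ , x∈Inner)) = ⊥-elim (x∉path (inner⇒onPath x∈Inner))
      ... | inj₂ (_ , inj₁ u₃≡x)      = ⊥-elim (x∉path (3F , u₃≡x))
      ... | inj₂ (inj₁ u₃≡σw , inj₂ refl) =
        ⊥-elim (w∉path (3F , ⟨$⟩-injective σ (trans σu₃≡u₃ u₃≡σw)))
      ... | inj₂ (inj₂ w≡σw , inj₂ refl) = sym w≡σw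

    inner-preimage-on-path : ∀ {y} → Inner y → OnPath (inverse σ ⟨$⟩ y)
    inner-preimage-on-path {y} y∈Inner with related (inverse σ ⟨$⟩ y)
    ... | inj₁ (inj₁ y≡x)           = subst OnPath (trans (sym (image-preimage σ y)) y≡x) (inner⇒onPath y∈Inner)
    ... | inj₁ (inj₂ (_ , x∈Inner)) = inner⇒onPath x∈Inner
    ... | inj₂ (y∈Tail , _)         = ⊥-elim (tail∩inner (subst Tail (image-preimage σ y) y∈Tail))
      where
      tail∩inner : y ∉ Tail
      tail∩inner (inj₁ refl) = u₃∉Inner y∈Inner
      tail∩inner (inj₂ refl) = w∉path (inner⇒onPath y∈Inner)

    moving-u₃-to-w⇒¬equidistant : σ ⟨$⟩ u₃ ≡ w → ¬ Equidistant
    moving-u₃-to-w⇒¬equidistant σu₃≡w equidistant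
      with inner-preimage-on-path (inj₁ (inj₂ refl)) | inner-preimage-on-path (inj₂ refl)
    ... | x₁∈path@(i , uᵢ≡x₁) | x₂∈path = u-distinct {1F} {2F} (λ ()) (⟨$⟩-injective (inverse σ) x₁≡x₂)
      where
      d₁ : Dist G (inverse σ ⟨$⟩ u₁) u₃ (3 ∸ toℕ i)
      d₁ = subst (λ x → Dist G x u₃ (3 ∸ toℕ i)) uᵢ≡x₁ (dist-to-u₃ i)
      d₂ : Dist G (inverse σ ⟨$⟩ u₂) u₃ (3 ∸ toℕ i)
      d₂ = dist-preimage σ (image-preimage σ u₂) σu₃≡w
             (equidistant (dist-image σ (image-preimage σ u₁) σu₃≡w d₁))
      x₁≡x₂ : inverse σ ⟨$⟩ u₁ ≡ inverse σ ⟨$⟩ u₂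
      x₁≡x₂ = dist-to-u₃-injective x₁∈path x₂∈path d₁ d₂

    equidistant⇒trivial : Equidistant → ¬ NonTrivial σ
    equidistant⇒trivial equidistant nontrivial with related u₃
    ... | inj₁ (inj₁ σu₃≡u₃)        = fixing-u₃⇒trivial σu₃≡u₃ nontrivial
    ... | inj₁ (inj₂ (_ , u₃∈Inner)) = u₃∉Inner u₃∈Inner
    ... | inj₂ (inj₁ u₃≡σu₃ , _)     = fixing-u₃⇒trivial (sym u₃≡σu₃) nontrivial
    ... | inj₂ (inj₂ w≡σu₃ , _)      = moving-u₃-to-w⇒¬equidistant (sym w≡σu₃) equidistant

  equidistant⇒split-merged-distinguishing : Equidistant → Distinguishing G (colour split-merged)
  equidistant⇒split-merged-distinguishing equidistant σ nontrivial preserves =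
    equidistant⇒trivial σ (separates split-merged ∘ preserves) equidistant nontrivial

  ¬distNum : ¬ DistNum G (suc k)
  ¬distNum (_ , minimal) = too-few-colours path-merged-distinguishing
    where
    too-few-colours : ∀ {col : Fin (3 + k) → Fin k} → ¬ Distinguishing G col
    too-few-colours distinguishing = 1+n≰n (minimal k _ distinguishing)
    path-merged-distinguishing : Distinguishing G (colour path-merged)
    path-merged-distinguishing σ nontrivial preserves = too-few-colours
      (equidistant⇒split-merged-distinguishing (path-merged-not-distinguishing⇒equidistant σ nontrivial preserves))

geodesic₃ : ∀ {n} {G : Graph n} {a b m} → Dist G a b (3 + m) → Geodesic₃ G
geodesic₃ {G = G} d@(step p (step q (step r rest)) , _) = record
  { u₀ = _ ; u₁ = _ ; u₂ = _ ; u₃ = _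
  ; u₀~u₁ = p ; u₁~u₂ = q ; u₂~u₃ = r
  ; shortest = proj₂ (WalkProperties.dist-prefix G d (step p (step q (step r here))) rest)
  }

distNum≡n∸2⇔≅P₄ : ∀ {n} {G : Graph n} → Geodesic₃ G → DistNum G (n ∸ 2) ⇔ G ≅ P₄
distNum≡n∸2⇔≅P₄ {n} {G} γ = mk⇔ forward backward
  where
  open Geodesic₃Properties γ
  forward : DistNum G (n ∸ 2) → G ≅ P₄
  forward distNum with all? onPath? | four≤n
  ... | yes spanning | _                 = spanning⇒≅P₄ spanning
  ... | no ¬spanning | s≤s (s≤s (s≤s _)) =
    let w , w∉path = ¬∀⟶∃¬ _ OnPath onPath? ¬spanning in ⊥-elim (SpareVertex.¬distNum γ w w∉path distNum)
  backward : G ≅ P₄ → DistNum G (n ∸ 2)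
  backward iso = subst (λ m → DistNum G (m ∸ 2)) (sym (↔⇒≡ (proj₁ iso))) (distNum-resp-≅ {G = G} {P₄} iso distNum-P₄)

lemma4p13 : ∀ {n} (G : Graph n) (d : ℕ) → Connected G → Diameter G d →
    (d ≡ 3 ⊎ d ≡ 4) → MetricDim G (n ∸ d) → (DistNum G (n ∸ 2) ⇔ (G ≅ P₄))
lemma4p13 G _ _ (_ , _ , _ , diametral) (inj₁ refl) _ = distNum≡n∸2⇔≅P₄ (geodesic₃ {m = 0} diametral)
lemma4p13 G _ _ (_ , _ , _ , diametral) (inj₂ refl) _ = distNum≡n∸2⇔≅P₄ (geodesic₃ {m = 1} diametral)
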